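{- Let $G=(V,E)$ be a finite connected graph (parallel edges allowed, no loops) and let $D\ge0$ be an effective divisor on $G$. Let $F$ be the set of $D$-blocking edges and let $U$ be (the node set of) a connected component of the graph $(V,E\setminus F)$. Then for every effective divisor $D'\sim D$ we have $\sum_{u\in U}D'(u)=\sum_{u\in U}D(u)$.
   Context: The Laplacian $Q(G)\in\mathbb{Z}^{V\times V}$ has $Q(G)_{ww}=\deg(w)$ and $Q(G)_{wz}=-(\text{number of edges between }w\text{ and }z)$ for $w\ne z$. A divisor is $D\in\mathbb{Z}^V$, effective if $D\ge0$; $D\sim D'$ if $D-D'=Q(G)x$ for some $x\in\mathbb{Z}^V$. For an effective divisor $D$, the relation $\equiv_D$ on $V$ is: $u\equiv_D v$ iff $x_u=x_v$ for every $x\in\mathbb{Z}^V$ with $D-Q(G)x\ge0$. An edge is $D$-blocking if its two ends are $\equiv_D$-equivalent. -}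

module Defs where

open import Data.Nat using (ℕ)
open import Data.Fin using (Fin; _≟_)
open import Data.Integer using (ℤ; +_; _+_; _-_; _*_; -_; _≤_)
open import Data.List using (List; []; _∷_; foldr; map; allFin; filter; length)
open import Data.List.Membership.Propositional using (_∈_)
open import Data.Bool using (Bool; true)
open import Data.Product using (_×_; Σ; ∃; proj₁; proj₂; _,_)
open import Data.Sum using (_⊎_)
open import Relation.Binary.PropositionalEquality using (_≡_; _≢_)
open import Relation.Nullary using (¬_; Dec; yes; no)
open import Relation.Nullary.Decidable using (_⊎-dec_; _×-dec_)
open import Level using (0ℓ)

-- A finite multigraph on vertex set Fin n: a list of edges (pairs of ends);
-- repeated entries are parallel edges.
Edge : ℕ → Set
Edge n = Fin n × Fin n

record Graph (n : ℕ) : Set where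
  field
    edges : List (Edge n)
    loopless : ∀ {e} → e ∈ edges → proj₁ e ≢ proj₂ e
open Graph public

sumℤ : List ℤ → ℤ
sumℤ = foldr _+_ (+ 0)

ΣV : ∀ {n} → (Fin n → ℤ) → ℤ
ΣV {n} f = sumℤ (map f (allFin n))

ΣU : ∀ {n} → (Fin n → Bool) → (Fin n → ℤ) → ℤ
ΣU {n} U f = sumℤ (map f (filter (λ u → U u Data.Bool.≟ true) (allFin n)))

Joins : ∀ {n} → Edge n → Fin n → Fin n → Set
Joins e w z = (proj₁ e ≡ w × proj₂ e ≡ z) ⊎ (proj₁ e ≡ z × proj₂ e ≡ w)

joins? : ∀ {n} (e : Edge n) (w z : Fin n) → Dec (Joins e w z)
joins? e w z = ((proj₁ e ≟ w) ×-dec (proj₂ e ≟ z)) ⊎-dec ((proj₁ e ≟ z) ×-dec (proj₂ e ≟ w))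

Incident : ∀ {n} → Edge n → Fin n → Set
Incident e w = proj₁ e ≡ w ⊎ proj₂ e ≡ w

incident? : ∀ {n} (e : Edge n) (w : Fin n) → Dec (Incident e w)
incident? e w = (proj₁ e ≟ w) ⊎-dec (proj₂ e ≟ w)

deg : ∀ {n} → Graph n → Fin n → ℕ
deg G w = length (filter (λ e → incident? e w) (edges G))

mult : ∀ {n} → Graph n → Fin n → Fin n → ℕ
mult G w z = length (filter (λ e → joins? e w z) (edges G))

Laplacian : ∀ {n} → Graph n → Fin n → Fin n → ℤ
Laplacian G w z with w ≟ z
... | yes _ = + deg G w
... | no  _ = - (+ mult G w z)

Divisor : ℕ → Set
Divisor n = Fin n → ℤ

Qx : ∀ {n} → Graph n → (Fin n → ℤ) → Divisor n
Qx G x w = ΣV (λ z → Laplacian G w z * x z)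

Effective : ∀ {n} → Divisor n → Set
Effective D = ∀ v → + 0 ≤ D v

LinEquiv : ∀ {n} → Graph n → Divisor n → Divisor n → Set
LinEquiv {n} G D D' = Σ (Fin n → ℤ) λ x → ∀ v → D v - D' v ≡ Qx G x v

EquivD : ∀ {n} → Graph n → Divisor n → Fin n → Fin n → Set
EquivD {n} G D u v =
  (x : Fin n → ℤ) → Effective (λ w → D w - Qx G x w) → x u ≡ x v

Blocking : ∀ {n} → Graph n → Divisor n → Edge n → Set
Blocking G D e = EquivD G D (proj₁ e) (proj₂ e)

data Reach {n} (G : Graph n) (P : Edge n → Set) (u : Fin n) : Fin n → Set where
  here : Reach G P u u
  step : ∀ {v w} (e : Edge n) → e ∈ edges G → P e → Joins e v w →
         Reach G P u v → Reach G P u w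

AllEdges : ∀ {n} → Edge n → Set
AllEdges _ = Data.Unit.⊤
  where import Data.Unit

Connected : ∀ {n} → Graph n → Set
Connected {n} G = Σ (Fin n) (λ _ → Data.Unit.⊤) × (∀ u v → Reach G AllEdges u v)
  where import Data.Unit

IsComponentOfNonBlocking : ∀ {n} → Graph n → Divisor n → (Fin n → Bool) → Set
IsComponentOfNonBlocking {n} G D U =
  Σ (Fin n) (λ u → U u ≡ true)
  × (∀ u v → U u ≡ true → U v ≡ true → Reach G (λ e → ¬ Blocking G D e) u v)
  × (∀ u v → U u ≡ true → Reach G (λ e → ¬ Blocking G D e) u v → U v ≡ true)

-- Write D - D' = Q x. The Laplacian is Σₑ ∂ₑ ∂ₑᵀ with ∂ₑ = δₐ - δ_b for an edge e = ab,
-- so Σ_{u∈U} (Q x)(u) = Σₑ (1_U(a) - 1_U(b)) (x_a - x_b): only edges leaving U contribute.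
-- Such an edge cannot be non-blocking, since U is a whole component of (V, E ∖ F); and
-- for a blocking edge x_a = x_b, because D - Q x = D' is effective. So the sum over U
-- of D - D' vanishes.

module Submission where

open import Defs
open import Data.Nat using (ℕ; zero; suc)
open import Data.Fin using (Fin; zero; suc; _≟_)
open import Data.Bool using (Bool; true; false)
import Data.Bool as Bool
open import Data.Integer using (ℤ; +_; 0ℤ; 1ℤ; -1ℤ; _+_; _-_; _*_; -_; _≤_)
import Data.Integer.Properties as ℤ
open import Data.Integer.Tactic.RingSolver using (solve-∀)
open import Data.List using (List; []; _∷_; map; filter; length; lookup; tabulate; allFin)
open import Data.List.Properties using (map-tabulate)
open import Data.List.Membership.Propositional using (_∈_)
open import Data.List.Membership.Propositional.Properties using (∈-lookup)
open import Data.Product using (_,_; proj₁; proj₂)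
open import Data.Sum using (inj₁; inj₂)
open import Data.Empty using (⊥-elim)
open import Function using (_∘_)
open import Relation.Nullary using (¬_; Dec; yes; no; does)
open import Relation.Nullary.Decidable using (decidable-stable)
open import Relation.Nullary.Negation using (¬¬-map)
open import Relation.Binary.PropositionalEquality
open import Algebra.Properties.Semiring.Sum ℤ.+-*-semiring
  using (sum-syntax; sum-cong-≗; sum-replicate-zero; ∑-distrib-+; ∑-comm;
         *-distribˡ-sum; *-distribʳ-sum)

⟦_⟧ : Bool → ℤ
⟦ true ⟧  = 1ℤ
⟦ false ⟧ = 0ℤ

∑-zero : ∀ {n} {f : Fin n → ℤ} → (∀ i → f i ≡ 0ℤ) → ∑[ i < n ] f i ≡ 0ℤ
∑-zero {n} f≗0 = trans (sum-cong-≗ f≗0) (sum-replicate-zero n)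

δ : ∀ {n} → Fin n → Fin n → ℤ
δ a w = ⟦ does (a ≟ w) ⟧

∑-δ : ∀ {n} (a : Fin n) (f : Fin n → ℤ) → ∑[ w < n ] (δ a w * f w) ≡ f a
∑-δ {suc n} zero f =
  trans (cong₂ _+_ (ℤ.*-identityˡ (f zero)) (∑-zero (λ w → ℤ.*-zeroˡ (f (suc w)))))
        (ℤ.+-identityʳ (f zero))
∑-δ {suc n} (suc a) f = trans (cong (_+_ 0ℤ) (∑-δ a (f ∘ suc))) (ℤ.+-identityˡ _)

sumℤ-tabulate : ∀ {n} (f : Fin n → ℤ) → sumℤ (tabulate f) ≡ ∑[ i < n ] f i
sumℤ-tabulate {zero}  f = refl
sumℤ-tabulate {suc n} f = cong (_+_ (f zero)) (sumℤ-tabulate (f ∘ suc))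

ΣV≡∑ : ∀ {n} (f : Fin n → ℤ) → ΣV f ≡ ∑[ i < n ] f i
ΣV≡∑ f = trans (cong sumℤ (map-tabulate (λ i → i) f)) (sumℤ-tabulate f)

sumℤ-filter : ∀ {A : Set} (U : A → Bool) (f : A → ℤ) (xs : List A) →
              sumℤ (map f (filter (λ a → U a Bool.≟ true) xs)) ≡ sumℤ (map (λ a → ⟦ U a ⟧ * f a) xs)
sumℤ-filter U f [] = refl
sumℤ-filter U f (x ∷ xs) with U x
... | true  = cong₂ _+_ (sym (ℤ.*-identityˡ (f x))) (sumℤ-filter U f xs)
... | false = trans (sumℤ-filter U f xs) (sym (ℤ.+-identityˡ _))

ΣU≡∑ : ∀ {n} (U : Fin n → Bool) (f : Fin n → ℤ) → ΣU U f ≡ ∑[ u < n ] (⟦ U u ⟧ * f u)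
ΣU≡∑ {n} U f = trans (sumℤ-filter U f (allFin n)) (ΣV≡∑ (λ u → ⟦ U u ⟧ * f u))

length-filter : ∀ {A : Set} {P : A → Set} (P? : ∀ a → Dec (P a)) (xs : List A) →
                + length (filter P? xs) ≡ ∑[ i < length xs ] ⟦ does (P? (lookup xs i)) ⟧
length-filter P? []       = refl
length-filter P? (x ∷ xs) with does (P? x)
... | true  = cong (_+_ 1ℤ) (length-filter P? xs)
... | false = trans (length-filter P? xs) (sym (ℤ.+-identityˡ _))

incidence : ∀ {n} → Edge n → Fin n → ℤ
incidence (a , b) w = δ a w - δ b w

∇ : ∀ {n} → (Fin n → ℤ) → Edge n → ℤ
∇ x (a , b) = x a - x b

∑-incidence : ∀ {n} (e : Edge n) (x : Fin n → ℤ) → ∑[ w < n ] (incidence e w * x w) ≡ ∇ x e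
∑-incidence {n} (a , b) x = begin
  ∑[ w < n ] ((δ a w - δ b w) * x w)                         ≡⟨ sum-cong-≗ (λ w → split (δ a w) (δ b w) (x w)) ⟩
  ∑[ w < n ] (δ a w * x w + δ b w * - x w)                   ≡⟨ ∑-distrib-+ (λ w → δ a w * x w) (λ w → δ b w * - x w) ⟩
  (∑[ w < n ] (δ a w * x w)) + (∑[ w < n ] (δ b w * - x w))  ≡⟨ cong₂ _+_ (∑-δ a x) (∑-δ b (-_ ∘ x)) ⟩
  x a - x b                                                  ∎
  where
  open ≡-Reasoning
  split : ∀ p q r → (p - q) * r ≡ p * r + q * - r
  split = solve-∀

incident-indicator : ∀ {n} (e : Edge n) (w : Fin n) → proj₁ e ≢ proj₂ e →
                     ⟦ does (incident? e w) ⟧ ≡ incidence e w * incidence e w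
incident-indicator (a , b) w a≢b with a ≟ w | b ≟ w
... | yes refl | yes refl = ⊥-elim (a≢b refl)
... | yes _    | no _     = refl
... | no _     | yes _    = refl
... | no _     | no _     = refl

joins-indicator : ∀ {n} (e : Edge n) (w z : Fin n) → proj₁ e ≢ proj₂ e → w ≢ z →
                  - ⟦ does (joins? e w z) ⟧ ≡ incidence e w * incidence e z
joins-indicator (a , b) w z a≢b w≢z with a ≟ w | b ≟ w | a ≟ z | b ≟ z
... | yes refl | yes refl | _        | _        = ⊥-elim (a≢b refl)
... | _        | _        | yes refl | yes refl = ⊥-elim (a≢b refl)
... | yes refl | _        | yes refl | _        = ⊥-elim (w≢z refl)
... | _        | yes refl | _        | yes refl = ⊥-elim (w≢z refl)
... | yes _    | no _     | no _     | yes _    = refl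
... | yes _    | no _     | no _     | no _     = refl
... | no _     | yes _    | yes _    | no _     = refl
... | no _     | yes _    | no _     | no _     = refl
... | no _     | no _     | yes _    | no _     = refl
... | no _     | no _     | no _     | yes _    = refl
... | no _     | no _     | no _     | no _     = refl

#edges : ∀ {n} → Graph n → ℕ
#edges G = length (edges G)

edge : ∀ {n} (G : Graph n) → Fin (#edges G) → Edge n
edge G = lookup (edges G)

laplacian≡∑-incidence : ∀ {n} (G : Graph n) (w z : Fin n) →
  Laplacian G w z ≡ ∑[ i < #edges G ] (incidence (edge G i) w * incidence (edge G i) z)
laplacian≡∑-incidence G w z with w ≟ z
... | yes refl = trans (length-filter (λ e → incident? e w) (edges G))
                       (sum-cong-≗ (λ i → incident-indicator (edge G i) w (loopless G (∈-lookup i))))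
... | no w≢z = begin
  - (+ mult G w z)                                   ≡⟨ cong -_ (length-filter (λ e → joins? e w z) (edges G)) ⟩
  - (∑[ i < #edges G ] joins i)                      ≡⟨ ℤ.-1*i≡-i _ ⟨
  -1ℤ * (∑[ i < #edges G ] joins i)                  ≡⟨ *-distribˡ-sum -1ℤ joins ⟩
  ∑[ i < #edges G ] (-1ℤ * joins i)                  ≡⟨ sum-cong-≗ (λ i → trans (ℤ.-1*i≡-i _) (entry i)) ⟩
  ∑[ i < #edges G ] (incidence (edge G i) w * incidence (edge G i) z) ∎
  where
  open ≡-Reasoning
  joins : Fin (#edges G) → ℤ
  joins i = ⟦ does (joins? (edge G i) w z) ⟧
  entry : ∀ i → - joins i ≡ incidence (edge G i) w * incidence (edge G i) z
  entry i = joins-indicator (edge G i) w z (loopless G (∈-lookup i)) w≢z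

Qx≡∑-incidence : ∀ {n} (G : Graph n) (x : Fin n → ℤ) (w : Fin n) →
  Qx G x w ≡ ∑[ i < #edges G ] (incidence (edge G i) w * ∇ x (edge G i))
Qx≡∑-incidence {n} G x w = begin
  Qx G x w                                                     ≡⟨ ΣV≡∑ (λ z → Laplacian G w z * x z) ⟩
  ∑[ z < n ] (Laplacian G w z * x z)                           ≡⟨ sum-cong-≗ (λ z → cong (_* x z) (laplacian≡∑-incidence G w z)) ⟩
  ∑[ z < n ] ((∑[ i < m ] (∂ i w * ∂ i z)) * x z)              ≡⟨ sum-cong-≗ (λ z → *-distribʳ-sum (x z) (λ i → ∂ i w * ∂ i z)) ⟩
  ∑[ z < n ] ∑[ i < m ] (∂ i w * ∂ i z * x z)                  ≡⟨ ∑-comm (λ z i → ∂ i w * ∂ i z * x z) ⟩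
  ∑[ i < m ] ∑[ z < n ] (∂ i w * ∂ i z * x z)                  ≡⟨ sum-cong-≗ (λ i → sum-cong-≗ (λ z → ℤ.*-assoc (∂ i w) (∂ i z) (x z))) ⟩
  ∑[ i < m ] ∑[ z < n ] (∂ i w * (∂ i z * x z))                ≡⟨ sum-cong-≗ (λ i → *-distribˡ-sum (∂ i w) (λ z → ∂ i z * x z)) ⟨
  ∑[ i < m ] (∂ i w * (∑[ z < n ] (∂ i z * x z)))              ≡⟨ sum-cong-≗ (λ i → cong (∂ i w *_) (∑-incidence (edge G i) x)) ⟩
  ∑[ i < m ] (∂ i w * ∇ x (edge G i))                          ∎
  where
  open ≡-Reasoning
  m = #edges G
  ∂ : Fin m → Fin n → ℤ
  ∂ i = incidence (edge G i)

∑-*-Qx≡∑-∇-*-∇ : ∀ {n} (G : Graph n) (y x : Fin n → ℤ) →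
  ∑[ u < n ] (y u * Qx G x u) ≡ ∑[ i < #edges G ] (∇ y (edge G i) * ∇ x (edge G i))
∑-*-Qx≡∑-∇-*-∇ {n} G y x = begin
  ∑[ u < n ] (y u * Qx G x u)                                  ≡⟨ sum-cong-≗ (λ u → cong (y u *_) (Qx≡∑-incidence G x u)) ⟩
  ∑[ u < n ] (y u * ∑[ i < m ] (∂ i u * ∇x i))                 ≡⟨ sum-cong-≗ (λ u → *-distribˡ-sum (y u) (λ i → ∂ i u * ∇x i)) ⟩
  ∑[ u < n ] ∑[ i < m ] (y u * (∂ i u * ∇x i))                 ≡⟨ ∑-comm (λ u i → y u * (∂ i u * ∇x i)) ⟩
  ∑[ i < m ] ∑[ u < n ] (y u * (∂ i u * ∇x i))                 ≡⟨ sum-cong-≗ (λ i → sum-cong-≗ (λ u → regroup (y u) (∂ i u) (∇x i))) ⟩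
  ∑[ i < m ] ∑[ u < n ] (∂ i u * y u * ∇x i)                   ≡⟨ sum-cong-≗ (λ i → *-distribʳ-sum (∇x i) (λ u → ∂ i u * y u)) ⟨
  ∑[ i < m ] ((∑[ u < n ] (∂ i u * y u)) * ∇x i)               ≡⟨ sum-cong-≗ (λ i → cong (_* ∇x i) (∑-incidence (edge G i) y)) ⟩
  ∑[ i < m ] (∇ y (edge G i) * ∇x i)                           ∎
  where
  open ≡-Reasoning
  m = #edges G
  ∂ : Fin m → Fin n → ℤ
  ∂ i = incidence (edge G i)
  ∇x : Fin m → ℤ
  ∇x i = ∇ x (edge G i)
  regroup : ∀ p q r → p * (q * r) ≡ q * p * r
  regroup = solve-∀

module _ {n} (G : Graph n) (D : Divisor n) where

  cut-edge-¬¬blocking : ∀ {U : Fin n → Bool} {e : Edge n} {u v : Fin n} →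
    IsComponentOfNonBlocking G D U → e ∈ edges G → Joins e u v →
    U u ≡ true → U v ≡ false → ¬ ¬ Blocking G D e
  cut-edge-¬¬blocking (_ , _ , closed) e∈G joins Uu Uv nonblocking
    with () ← trans (sym (closed _ _ Uu (step _ e∈G nonblocking joins here))) Uv

  ¬¬blocking⇒∇≡0 : ∀ {x : Fin n → ℤ} {e : Edge n} →
    Effective (λ w → D w - Qx G x w) → ¬ ¬ Blocking G D e → ∇ x e ≡ 0ℤ
  ¬¬blocking⇒∇≡0 {x} {a , b} D-Qx≥0 blocks =
    ℤ.i≡j⇒i-j≡0 (decidable-stable (x a ℤ.≟ x b) (¬¬-map (λ a≡b → a≡b x D-Qx≥0) blocks))

  component-edge-term≡0 : ∀ {U : Fin n → Bool} {x : Fin n → ℤ} →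
    IsComponentOfNonBlocking G D U → Effective (λ w → D w - Qx G x w) →
    ∀ e → e ∈ edges G → ∇ (⟦_⟧ ∘ U) e * ∇ x e ≡ 0ℤ
  component-edge-term≡0 {U} comp D-Qx≥0 (a , b) e∈G with U a in Ua | U b in Ub
  ... | true  | true  = refl
  ... | false | false = refl
  ... | true  | false =
    trans (ℤ.*-identityˡ _) (¬¬blocking⇒∇≡0 D-Qx≥0 (cut-edge-¬¬blocking comp e∈G (inj₁ (refl , refl)) Ua Ub))
  ... | false | true  =
    trans (ℤ.-1*i≡-i _) (cong -_ (¬¬blocking⇒∇≡0 D-Qx≥0 (cut-edge-¬¬blocking comp e∈G (inj₂ (refl , refl)) Ub Ua)))

lemma3 : ∀ {n} (G : Graph n) → Connected G →
         (D : Divisor n) → Effective D →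
         (U : Fin n → Bool) → IsComponentOfNonBlocking G D U →
         (D' : Divisor n) → Effective D' → LinEquiv G D D' →
         ΣU U D' ≡ ΣU U D
lemma3 {n} G _ D _ U comp D' D'≥0 (x , D-D'≡Qx) = sym (begin
  ΣU U D                                                           ≡⟨ ΣU≡∑ U D ⟩
  ∑[ u < n ] (⟦ U u ⟧ * D u)                                       ≡⟨ sum-cong-≗ (λ u → cong (⟦ U u ⟧ *_) (D≡D'+Qx u)) ⟩
  ∑[ u < n ] (⟦ U u ⟧ * (D' u + Qx G x u))                         ≡⟨ sum-cong-≗ (λ u → ℤ.*-distribˡ-+ ⟦ U u ⟧ (D' u) (Qx G x u)) ⟩
  ∑[ u < n ] (⟦ U u ⟧ * D' u + ⟦ U u ⟧ * Qx G x u)                 ≡⟨ ∑-distrib-+ (λ u → ⟦ U u ⟧ * D' u) (λ u → ⟦ U u ⟧ * Qx G x u) ⟩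
  (∑[ u < n ] (⟦ U u ⟧ * D' u)) + (∑[ u < n ] (⟦ U u ⟧ * Qx G x u)) ≡⟨ cong (_+_ (∑[ u < n ] (⟦ U u ⟧ * D' u))) flux≡0 ⟩
  (∑[ u < n ] (⟦ U u ⟧ * D' u)) + 0ℤ                               ≡⟨ ℤ.+-identityʳ _ ⟩
  ∑[ u < n ] (⟦ U u ⟧ * D' u)                                      ≡⟨ ΣU≡∑ U D' ⟨
  ΣU U D'                                                          ∎)
  where
  open ≡-Reasoning
  add-sub : ∀ a b → a ≡ b + (a - b)
  add-sub = solve-∀

  sub-sub : ∀ a b → b ≡ a - (a - b)
  sub-sub = solve-∀

  D≡D'+Qx : ∀ u → D u ≡ D' u + Qx G x u
  D≡D'+Qx u = trans (add-sub (D u) (D' u)) (cong (_+_ (D' u)) (D-D'≡Qx u))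

  D-Qx≥0 : Effective (λ w → D w - Qx G x w)
  D-Qx≥0 w = subst (0ℤ ≤_) (trans (sub-sub (D w) (D' w)) (cong (_-_ (D w)) (D-D'≡Qx w))) (D'≥0 w)

  flux≡0 : ∑[ u < n ] (⟦ U u ⟧ * Qx G x u) ≡ 0ℤ
  flux≡0 = trans (∑-*-Qx≡∑-∇-*-∇ G (⟦_⟧ ∘ U) x)
                 (∑-zero (λ i → component-edge-term≡0 G D comp D-Qx≥0 (edge G i) (∈-lookup i)))
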